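{- Let $\varphi(x_1,\dots,x_k)$ be an MSO formula in \textsf{TOTO} with $k$ free element variables. For every $r \in \mathbb{N}$ and $q \in \{0,\dots,r-1\}$ there exists an MSO sentence $card^{\varphi}_{q,r}$ in \textsf{TOTO} of length $r^{O(k+1)}\cdot|\varphi|$ such that for every permutation $\pi$ we have $\pi \models card^{\varphi}_{q,r}$ if and only if \[\bigl|\{\mathbf{a} \in \pi^k : (\pi,\mathbf{a}) \models \varphi(\mathbf{x})\}\bigr| \equiv q \pmod r,\] where $\pi^k$ denotes the set of $k$-tuples of elements of $\pi$.
   Context: A permutation $\pi=\pi_1\cdots\pi_n$ of $[n]$ is identified with its diagram $S_\pi=\{(i,\pi_i): i\in[n]\}$ and viewed as a relational structure $(S_\pi,\prec_1,\prec_2)$ over the signature with two binary relation symbols $<_1,<_2$, where $\prec_1$ orders points by $x$-coordinate and $\prec_2$ by $y$-coordinate. \textsf{TOTO} (Theory of Two Orders) is the theory stating that $<_1$ and $<_2$ are linear orders. MSO (monadic second-order) formulas over this signature are built from atomic formulas $x=y$, $x<_1 y$, $x<_2 y$, $x\in X$ using Boolean connectives and quantification over element variables and set variables. $(\pi,\mathbf{a})\models\varphi(\mathbf{x})$ means $\varphi$ holds in $\pi$ when its free variables $x_1,\dots,x_k$ are interpreted as $a_1,\dots,a_k$. The length $|\varphi|$ is the number of symbols of $\varphi$. -}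

module Defs where

open import Data.Nat using (ℕ; zero; suc; _+_; _<ᵇ_)
open import Data.Bool using (Bool; true; false; _∧_; _∨_; not; if_then_else_)
open import Data.Fin using (Fin; toℕ) renaming (_≟_ to _≟ᶠ_)
open import Data.Fin.Permutation using (Permutation′; _⟨$⟩ʳ_)
open import Data.Vec using (Vec; []; _∷_; lookup)
open import Data.List using (List; []; _∷_; map; concatMap; allFin; filter; length)
open import Data.Bool.ListAction using (any; all)
open import Relation.Nullary.Decidable using (⌊_⌋)
open import Relation.Unary using (Decidable)
open import Relation.Binary.PropositionalEquality using (_≡_)
open import Data.Bool.Properties using () renaming (_≟_ to _≟ᵇ_)

Subset : ℕ → Set
Subset n = Vec Bool n

-- MSO formulas over the signature {<₁, <₂}, with de Bruijn indices:
-- k = number of free element variables, m = number of free set variables.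
data Formula : ℕ → ℕ → Set where
  _≐_   : ∀ {k m} → Fin k → Fin k → Formula k m
  _<₁_  : ∀ {k m} → Fin k → Fin k → Formula k m
  _<₂_  : ∀ {k m} → Fin k → Fin k → Formula k m
  _∈̇_   : ∀ {k m} → Fin k → Fin m → Formula k m
  ¬̇_    : ∀ {k m} → Formula k m → Formula k m
  _∧̇_   : ∀ {k m} → Formula k m → Formula k m → Formula k m
  _∨̇_   : ∀ {k m} → Formula k m → Formula k m → Formula k m
  _⇒̇_   : ∀ {k m} → Formula k m → Formula k m → Formula k m
  ∃ₑ    : ∀ {k m} → Formula (suc k) m → Formula k m
  ∀ₑ    : ∀ {k m} → Formula (suc k) m → Formula k m
  ∃ₛ    : ∀ {k m} → Formula k (suc m) → Formula k m
  ∀ₛ    : ∀ {k m} → Formula k (suc m) → Formula k m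

-- Length = number of symbols: an atom "x R y" has 3 symbols, a connective
-- or quantifier-with-its-variable contributes 1 or 2 symbols.
len : ∀ {k m} → Formula k m → ℕ
len (x ≐ y)   = 3
len (x <₁ y)  = 3
len (x <₂ y)  = 3
len (x ∈̇ X)   = 3
len (¬̇ φ)     = 1 + len φ
len (φ ∧̇ ψ)   = 1 + len φ + len ψ
len (φ ∨̇ ψ)   = 1 + len φ + len ψ
len (φ ⇒̇ ψ)   = 1 + len φ + len ψ
len (∃ₑ φ)    = 2 + len φ
len (∀ₑ φ)    = 2 + len φ
len (∃ₛ φ)    = 2 + len φ
len (∀ₛ φ)    = 2 + len φ

tuples : ∀ {A : Set} → List A → (k : ℕ) → List (Vec A k)
tuples xs zero    = [] ∷ []
tuples xs (suc k) = concatMap (λ x → map (x ∷_) (tuples xs k)) xs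

allSubsets : (n : ℕ) → List (Subset n)
allSubsets n = tuples (true ∷ false ∷ []) n

-- Satisfaction in the permutation diagram S_π, whose points (i, π i) are
-- identified with their index i : Fin n.  (i,π i) ≺₁ (j,π j) iff i < j,
-- and ≺₂ iff π i < π j.
sat : ∀ {n k m} → Permutation′ n → Formula k m → Vec (Fin n) k → Vec (Subset n) m → Bool
sat π (x ≐ y)  a S = ⌊ lookup a x ≟ᶠ lookup a y ⌋
sat π (x <₁ y) a S = toℕ (lookup a x) <ᵇ toℕ (lookup a y)
sat π (x <₂ y) a S = toℕ (π ⟨$⟩ʳ lookup a x) <ᵇ toℕ (π ⟨$⟩ʳ lookup a y)
sat π (x ∈̇ X)  a S = lookup (lookup S X) (lookup a x)
sat π (¬̇ φ)    a S = not (sat π φ a S)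
sat π (φ ∧̇ ψ)  a S = sat π φ a S ∧ sat π ψ a S
sat π (φ ∨̇ ψ)  a S = sat π φ a S ∨ sat π ψ a S
sat π (φ ⇒̇ ψ)  a S = not (sat π φ a S) ∨ sat π ψ a S
sat {n} π (∃ₑ φ) a S = any (λ x → sat π φ (x ∷ a) S) (allFin n)
sat {n} π (∀ₑ φ) a S = all (λ x → sat π φ (x ∷ a) S) (allFin n)
sat {n} π (∃ₛ φ) a S = any (λ X → sat π φ a (X ∷ S)) (allSubsets n)
sat {n} π (∀ₛ φ) a S = all (λ X → sat π φ a (X ∷ S)) (allSubsets n)

_⊨_ : ∀ {n} → Permutation′ n → Formula 0 0 → Set
π ⊨ ψ = sat π ψ [] [] ≡ true

_,_⊨_ : ∀ {n k} → Permutation′ n → Vec (Fin n) k → Formula k 0 → Bool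
π , a ⊨ φ = sat π φ a []

countSat : ∀ {n k} → Permutation′ n → Formula k 0 → ℕ
countSat {n} {k} π φ = length (filter (λ a → (π , a ⊨ φ) ≟ᵇ true) (tuples (allFin n) k))

-- Free variables are eliminated one at a time. Say that formulas θ₀, …, θ_{r-1} represent a
-- weight W on tuples if θᵢ(a) holds exactly when W(a) ≡ i (mod r); for instance the formulas
-- (φ ∧ 1 ≡ i) ∨ (¬φ ∧ 0 ≡ i) represent the indicator of φ. From a representation of W(x, c) one
-- obtains one of Σₓ W(x, c) by guessing sets X₀, …, X_{r-1} and requiring that each point y lie
-- exactly in the Xᵢ with i ≡ Σ_{x ≤₁ y} W(x, c). This is a local condition along <₁ (the residue
-- at y is the one at its left neighbour plus that of W(y, c)), and the residue at the rightmost
-- point is that of the whole sum. Each step multiplies the length by O(r³), so k steps give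
-- length r^{O(k)} · |φ|.

module Submission where

open import Defs
open import Data.Bool using (Bool; true; false; _∧_; _∨_; not; if_then_else_; T)
open import Data.Bool.ListAction using (any; all; or; and)
open import Data.Bool.Properties using (T-≡; T-∧; T-∨) renaming (_≟_ to _≟ᵇ_)
open import Data.Empty using (⊥-elim)
open import Data.Fin using (Fin; zero; suc; toℕ; fromℕ<; _≟_)
open import Data.Fin.Permutation using (Permutation′; _⟨$⟩ʳ_)
open import Data.Fin.Properties using (toℕ<n; toℕ-fromℕ<; fromℕ<-cong)
open import Data.List using (List; []; _∷_; map; allFin; concatMap; filter; length)
open import Data.List.Membership.Propositional using (_∈_; lose)
open import Data.List.Membership.Propositional.Properties using (∈-allFin; ∈-map⁺; ∈-concatMap⁺)
open import Data.List.Properties using (map-cong; map-∘; map-concatMap; map-tabulate)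
import Data.List.Relation.Unary.All as All
open import Data.List.Relation.Unary.All.Properties using (all⁺; all⁻)
open import Data.List.Relation.Unary.Any using (here; there; satisfied)
open import Data.List.Relation.Unary.Any.Properties using (any⁺; any⁻)
open import Data.Nat using (ℕ; zero; suc; _+_; _*_; _^_; _≤_; _<_; z≤n; s≤s; NonZero; >-nonZero; >-nonZero⁻¹)
open import Data.Nat.DivMod using (_%_; _mod_; m%n<n; %-distribˡ-+; n%1≡0)
open import Data.Nat.ListAction using (sum)
open import Data.Nat.ListAction.Properties using (sum-++)
open import Data.Nat.Properties
  using ( <ᵇ⇒<; <⇒<ᵇ; ≤-refl; ≤-reflexive; ≤-trans; ≤-antisym; <⇒≤; <⇒≱; ≮⇒≥; <-≤-trans; ≤-<-trans
        ; n≤0⇒n≡0; n≤1+n; m≤m+n; m≤m*n; m≤n*m; suc-injective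
        ; +-identityʳ; +-assoc; +-suc; +-mono-≤; +-monoˡ-≤; +-monoʳ-≤; +-commutativeSemigroup
        ; *-identityˡ; *-assoc; *-comm; *-mono-≤; *-monoˡ-≤
        ; ^-zeroˡ; ^-*-assoc; ^-distribˡ-+-*; ^-monoˡ-≤; module ≤-Reasoning )
open import Algebra.Properties.CommutativeSemigroup +-commutativeSemigroup using (interchange)
open import Data.Nat.Tactic.RingSolver using (solve-∀)
open import Data.Product using (∃; Σ; _×_; _,_)
import Data.Product as Product
open import Data.Sum using (_⊎_; inj₁; inj₂)
import Data.Sum as Sum
open import Data.Unit using (tt)
open import Data.Vec using (Vec; []; _∷_; lookup; tabulate)
open import Data.Vec.Properties using (lookup∘tabulate)
open import Function using (_∘_; id)
open import Function.Bundles using (_⇔_; mk⇔; Equivalence)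
open import Function.Properties.Equivalence using () renaming (trans to ⇔-trans; sym to ⇔-sym)
open import Relation.Binary.PropositionalEquality
  using (_≡_; refl; sym; trans; cong; cong₂; subst; module ≡-Reasoning)
open import Relation.Nullary using (¬_; Dec; yes; no)
open import Relation.Nullary.Decidable using (⌊_⌋; toWitness; fromWitness)

open Equivalence using (to; from)

T-not : ∀ {x} → T (not x) ⇔ (¬ T x)
T-not {true}  = mk⇔ (λ ()) (λ ¬t → ¬t tt)
T-not {false} = mk⇔ (λ _ ()) (λ _ → tt)

T-⇒ : ∀ {x y} → T (not x ∨ y) ⇔ (T x → T y)
T-⇒ {true}  = mk⇔ (λ t _ → t) (λ f → f tt)
T-⇒ {false} = mk⇔ (λ _ ()) (λ _ → tt)

T-any : ∀ {A : Set} (p : A → Bool) {xs : List A} → (∀ x → x ∈ xs) → T (any p xs) ⇔ ∃ (T ∘ p)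
T-any p {xs} listed = mk⇔ (satisfied ∘ any⁻ p xs) (λ (x , px) → any⁺ p (lose (listed x) px))

T-all : ∀ {A : Set} (p : A → Bool) {xs : List A} → (∀ x → x ∈ xs) → T (all p xs) ⇔ (∀ x → T (p x))
T-all p {xs} listed = mk⇔ (λ h x → All.lookup (all⁺ p xs h) (listed x))
                          (λ h → all⁻ p (All.tabulate {xs = xs} (λ {x} _ → h x)))

∈-tuples : ∀ {A : Set} {xs : List A} {k} (v : Vec A k) → (∀ i → lookup v i ∈ xs) → v ∈ tuples xs k
∈-tuples []      _      = here refl
∈-tuples (x ∷ v) listed = ∈-concatMap⁺ _ (lose (listed zero) (∈-map⁺ (x ∷_) (∈-tuples v (listed ∘ suc))))

∈-allSubsets : ∀ {n} (X : Subset n) → X ∈ allSubsets n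
∈-allSubsets X = ∈-tuples X (λ i → listed (lookup X i))
  where
  listed : ∀ b → b ∈ true ∷ false ∷ []
  listed true  = here refl
  listed false = there (here refl)

sum-map-+ : ∀ {A : Set} (f g : A → ℕ) xs → sum (map (λ x → f x + g x) xs) ≡ sum (map f xs) + sum (map g xs)
sum-map-+ f g []       = refl
sum-map-+ f g (x ∷ xs) = trans (cong (f x + g x +_) (sum-map-+ f g xs)) (interchange (f x) (g x) _ _)

sum-map-zero : ∀ {A : Set} (xs : List A) → sum (map (λ _ → 0) xs) ≡ 0
sum-map-zero []       = refl
sum-map-zero (x ∷ xs) = sum-map-zero xs

sum-map-comm : ∀ {A B : Set} (f : A → B → ℕ) xs ys →
               sum (map (λ x → sum (map (f x) ys)) xs) ≡ sum (map (λ y → sum (map (λ x → f x y) xs)) ys)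
sum-map-comm f []       ys = sym (sum-map-zero ys)
sum-map-comm f (x ∷ xs) ys = trans (cong (sum (map (f x) ys) +_) (sum-map-comm f xs ys))
                                   (sym (sum-map-+ (f x) _ ys))

sum-concatMap : ∀ {A : Set} (g : A → List ℕ) xs → sum (concatMap g xs) ≡ sum (map (sum ∘ g) xs)
sum-concatMap g []       = refl
sum-concatMap g (x ∷ xs) = trans (sum-++ (g x) _) (cong (sum (g x) +_) (sum-concatMap g xs))

sum-tuples : ∀ {A : Set} {k} (W : Vec A (suc k) → ℕ) xs →
             sum (map W (tuples xs (suc k))) ≡ sum (map (λ c → sum (map (λ x → W (x ∷ c)) xs)) (tuples xs k))
sum-tuples {k = k} W xs = begin
  sum (map W (concatMap (λ x → map (x ∷_) cs) xs))
    ≡⟨ cong sum (map-concatMap W _ xs) ⟩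
  sum (concatMap (λ x → map W (map (x ∷_) cs)) xs)
    ≡⟨ sum-concatMap _ xs ⟩
  sum (map (λ x → sum (map W (map (x ∷_) cs))) xs)
    ≡⟨ cong sum (map-cong (λ x → cong sum (sym (map-∘ cs))) xs) ⟩
  sum (map (λ x → sum (map (λ c → W (x ∷ c)) cs)) xs)
    ≡⟨ sum-map-comm (λ x c → W (x ∷ c)) xs cs ⟩
  sum (map (λ c → sum (map (λ x → W (x ∷ c)) xs)) cs) ∎
  where
  open ≡-Reasoning
  cs = tuples xs k

length-filter≡sum : ∀ {A : Set} (p : A → Bool) xs →
                    length (filter (λ x → p x ≟ᵇ true) xs) ≡ sum (map (λ x → if p x then 1 else 0) xs)
length-filter≡sum p []       = refl
length-filter≡sum p (x ∷ xs) with p x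
... | true  = cong suc (length-filter≡sum p xs)
... | false = length-filter≡sum p xs

prefixSum : ∀ {n} → (Fin n → ℕ) → ℕ → ℕ
prefixSum         f zero    = 0
prefixSum {zero}  f (suc t) = 0
prefixSum {suc n} f (suc t) = f zero + prefixSum (f ∘ suc) t

prefixSum-suc : ∀ {n} (f : Fin n → ℕ) y → prefixSum f (suc (toℕ y)) ≡ prefixSum f (toℕ y) + f y
prefixSum-suc f zero    = +-identityʳ (f zero)
prefixSum-suc f (suc y) = trans (cong (f zero +_) (prefixSum-suc (f ∘ suc) y)) (sym (+-assoc (f zero) _ _))

prefixSum-all : ∀ {n} (f : Fin n → ℕ) → prefixSum f n ≡ sum (map f (allFin n))
prefixSum-all {zero}  f = refl
prefixSum-all {suc n} f =
  cong (f zero +_) (trans (prefixSum-all (f ∘ suc))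
                          (cong sum (trans (map-tabulate id (f ∘ suc)) (sym (map-tabulate suc f)))))

⊤̇ : ∀ {k m} → Formula k m
⊤̇ = ∀ₑ (zero ≐ zero)

⌜_⌝ : ∀ {k m} {P : Set} → Dec P → Formula k m
⌜ P? ⌝ = if ⌊ P? ⌋ then ⊤̇ else ¬̇ ⊤̇

_⇔̇_ : ∀ {k m} {P : Set} → Formula k m → Dec P → Formula k m
φ ⇔̇ P? = if ⌊ P? ⌋ then φ else ¬̇ φ

⋀ : ∀ {k m} r → (Fin r → Formula k m) → Formula k m
⋀ zero    φ = ⊤̇
⋀ (suc r) φ = φ zero ∧̇ ⋀ r (φ ∘ suc)

∃ₛ* : ∀ {k} r → Formula k r → Formula k 0
∃ₛ* zero    φ = φ
∃ₛ* (suc r) φ = ∃ₛ* r (∃ₛ φ)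

liftSets : ∀ {m m′} → (Fin m → Fin m′) → Fin (suc m) → Fin (suc m′)
liftSets σ zero    = zero
liftSets σ (suc X) = suc (σ X)

lookup-liftSets : ∀ {A : Set} {m m′} {σ : Fin m → Fin m′} {S : Vec A m} {S′ : Vec A m′} {X} →
                  (∀ Y → lookup S′ (σ Y) ≡ lookup S Y) → ∀ Y → lookup (X ∷ S′) (liftSets σ Y) ≡ lookup (X ∷ S) Y
lookup-liftSets agree zero    = refl
lookup-liftSets agree (suc Y) = agree Y

renameSets : ∀ {k m m′} → (Fin m → Fin m′) → Formula k m → Formula k m′
renameSets σ (x ≐ y)  = x ≐ y
renameSets σ (x <₁ y) = x <₁ y
renameSets σ (x <₂ y) = x <₂ y
renameSets σ (x ∈̇ X)  = x ∈̇ σ X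
renameSets σ (¬̇ φ)    = ¬̇ renameSets σ φ
renameSets σ (φ ∧̇ ψ)  = renameSets σ φ ∧̇ renameSets σ ψ
renameSets σ (φ ∨̇ ψ)  = renameSets σ φ ∨̇ renameSets σ ψ
renameSets σ (φ ⇒̇ ψ)  = renameSets σ φ ⇒̇ renameSets σ ψ
renameSets σ (∃ₑ φ)   = ∃ₑ (renameSets σ φ)
renameSets σ (∀ₑ φ)   = ∀ₑ (renameSets σ φ)
renameSets σ (∃ₛ φ)   = ∃ₛ (renameSets (liftSets σ) φ)
renameSets σ (∀ₛ φ)   = ∀ₛ (renameSets (liftSets σ) φ)

weakenSets : ∀ {k m} → Formula k 0 → Formula k m
weakenSets = renameSets (λ ())

leftmost : ∀ {k m} → Formula (suc k) m
leftmost = ¬̇ ∃ₑ (zero <₁ suc zero)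

rightmost : ∀ {k m} → Formula (suc k) m
rightmost = ¬̇ ∃ₑ (suc zero <₁ zero)

leftNeighbour : ∀ {k m} → Formula (suc (suc k)) m
leftNeighbour = (zero <₁ suc zero) ∧̇ (¬̇ ∃ₑ ((suc zero <₁ zero) ∧̇ (zero <₁ suc (suc zero))))

empty : ∀ {k m} → Formula k m
empty = ¬̇ ∃ₑ ⊤̇

Fin-interval-empty : ∀ {n a b} → b ≤ n → (∀ (u : Fin n) → ¬ (a ≤ toℕ u × toℕ u < b)) ⇔ b ≤ a
Fin-interval-empty {a = a} {b} b≤n = mk⇔
  (λ gap → ≮⇒≥ λ a<b → let u<n = <-≤-trans a<b b≤n in
     gap (fromℕ< u<n) (≤-reflexive (sym (toℕ-fromℕ< u<n)) , subst (_< b) (sym (toℕ-fromℕ< u<n)) a<b))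
  (λ b≤a u (a≤u , u<b) → <⇒≱ (≤-<-trans a≤u u<b) b≤a)

module Semantics {n : ℕ} (π : Permutation′ n) where

  ⟦_⟧ : ∀ {k m} → Formula k m → Vec (Fin n) k → Vec (Subset n) m → Set
  ⟦ x ≐ y ⟧  a S = lookup a x ≡ lookup a y
  ⟦ x <₁ y ⟧ a S = toℕ (lookup a x) < toℕ (lookup a y)
  ⟦ x <₂ y ⟧ a S = toℕ (π ⟨$⟩ʳ lookup a x) < toℕ (π ⟨$⟩ʳ lookup a y)
  ⟦ x ∈̇ X ⟧  a S = T (lookup (lookup S X) (lookup a x))
  ⟦ ¬̇ φ ⟧    a S = ¬ ⟦ φ ⟧ a S
  ⟦ φ ∧̇ ψ ⟧  a S = ⟦ φ ⟧ a S × ⟦ ψ ⟧ a S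
  ⟦ φ ∨̇ ψ ⟧  a S = ⟦ φ ⟧ a S ⊎ ⟦ ψ ⟧ a S
  ⟦ φ ⇒̇ ψ ⟧  a S = ⟦ φ ⟧ a S → ⟦ ψ ⟧ a S
  ⟦ ∃ₑ φ ⟧   a S = ∃ λ x → ⟦ φ ⟧ (x ∷ a) S
  ⟦ ∀ₑ φ ⟧   a S = ∀ x → ⟦ φ ⟧ (x ∷ a) S
  ⟦ ∃ₛ φ ⟧   a S = ∃ λ X → ⟦ φ ⟧ a (X ∷ S)
  ⟦ ∀ₛ φ ⟧   a S = ∀ X → ⟦ φ ⟧ a (X ∷ S)

  sat⇔⟦⟧ : ∀ {k m} (φ : Formula k m) {a S} → T (sat π φ a S) ⇔ ⟦ φ ⟧ a S
  sat⇔⟦⟧ (x ≐ y)  = mk⇔ toWitness fromWitness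
  sat⇔⟦⟧ (x <₁ y) = mk⇔ (<ᵇ⇒< _ _) <⇒<ᵇ
  sat⇔⟦⟧ (x <₂ y) = mk⇔ (<ᵇ⇒< _ _) <⇒<ᵇ
  sat⇔⟦⟧ (x ∈̇ X)  = mk⇔ id id
  sat⇔⟦⟧ (¬̇ φ)    = mk⇔ (λ h ⟦φ⟧ → to T-not h (from (sat⇔⟦⟧ φ) ⟦φ⟧))
                        (λ h → from T-not (h ∘ to (sat⇔⟦⟧ φ)))
  sat⇔⟦⟧ (φ ∧̇ ψ)  = mk⇔ (Product.map (to (sat⇔⟦⟧ φ)) (to (sat⇔⟦⟧ ψ)) ∘ to T-∧)
                        (from T-∧ ∘ Product.map (from (sat⇔⟦⟧ φ)) (from (sat⇔⟦⟧ ψ)))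
  sat⇔⟦⟧ (φ ∨̇ ψ)  = mk⇔ (Sum.map (to (sat⇔⟦⟧ φ)) (to (sat⇔⟦⟧ ψ)) ∘ to T-∨)
                        (from T-∨ ∘ Sum.map (from (sat⇔⟦⟧ φ)) (from (sat⇔⟦⟧ ψ)))
  sat⇔⟦⟧ (φ ⇒̇ ψ)  = mk⇔ (λ h → to (sat⇔⟦⟧ ψ) ∘ to T-⇒ h ∘ from (sat⇔⟦⟧ φ))
                        (λ h → from T-⇒ (from (sat⇔⟦⟧ ψ) ∘ h ∘ to (sat⇔⟦⟧ φ)))
  sat⇔⟦⟧ (∃ₑ φ)   = mk⇔ (Product.map₂ (to (sat⇔⟦⟧ φ)) ∘ to (T-any _ ∈-allFin))
                        (from (T-any _ ∈-allFin) ∘ Product.map₂ (from (sat⇔⟦⟧ φ)))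
  sat⇔⟦⟧ (∀ₑ φ)   = mk⇔ (λ h x → to (sat⇔⟦⟧ φ) (to (T-all _ ∈-allFin) h x))
                        (λ h → from (T-all _ ∈-allFin) (λ x → from (sat⇔⟦⟧ φ) (h x)))
  sat⇔⟦⟧ (∃ₛ φ)   = mk⇔ (Product.map₂ (to (sat⇔⟦⟧ φ)) ∘ to (T-any _ ∈-allSubsets))
                        (from (T-any _ ∈-allSubsets) ∘ Product.map₂ (from (sat⇔⟦⟧ φ)))
  sat⇔⟦⟧ (∀ₛ φ)   = mk⇔ (λ h X → to (sat⇔⟦⟧ φ) (to (T-all _ ∈-allSubsets) h X))
                        (λ h → from (T-all _ ∈-allSubsets) (λ X → from (sat⇔⟦⟧ φ) (h X)))

  sat-renameSets : ∀ {k m m′} (σ : Fin m → Fin m′) (φ : Formula k m) {a S S′} →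
                   (∀ X → lookup S′ (σ X) ≡ lookup S X) → sat π (renameSets σ φ) a S′ ≡ sat π φ a S
  sat-renameSets σ (x ≐ y)  agree = refl
  sat-renameSets σ (x <₁ y) agree = refl
  sat-renameSets σ (x <₂ y) agree = refl
  sat-renameSets σ (x ∈̇ X)  {a} agree = cong (λ Y → lookup Y (lookup a x)) (agree X)
  sat-renameSets σ (¬̇ φ)    agree = cong not (sat-renameSets σ φ agree)
  sat-renameSets σ (φ ∧̇ ψ)  agree = cong₂ _∧_ (sat-renameSets σ φ agree) (sat-renameSets σ ψ agree)
  sat-renameSets σ (φ ∨̇ ψ)  agree = cong₂ _∨_ (sat-renameSets σ φ agree) (sat-renameSets σ ψ agree)
  sat-renameSets σ (φ ⇒̇ ψ)  agree =
    cong₂ (λ u v → not u ∨ v) (sat-renameSets σ φ agree) (sat-renameSets σ ψ agree)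
  sat-renameSets σ (∃ₑ φ)   agree = cong or (map-cong (λ x → sat-renameSets σ φ agree) (allFin n))
  sat-renameSets σ (∀ₑ φ)   agree = cong and (map-cong (λ x → sat-renameSets σ φ agree) (allFin n))
  sat-renameSets σ (∃ₛ φ)   agree =
    cong or (map-cong (λ X → sat-renameSets (liftSets σ) φ (lookup-liftSets agree)) (allSubsets n))
  sat-renameSets σ (∀ₛ φ)   agree =
    cong and (map-cong (λ X → sat-renameSets (liftSets σ) φ (lookup-liftSets agree)) (allSubsets n))

  ⟦weakenSets⟧ : ∀ {k m} (φ : Formula k 0) {a} {S : Vec (Subset n) m} → ⟦ weakenSets φ ⟧ a S ⇔ ⟦ φ ⟧ a []
  ⟦weakenSets⟧ φ = mk⇔ (to (sat⇔⟦⟧ φ) ∘ subst T same ∘ from (sat⇔⟦⟧ (weakenSets φ)))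
                       (to (sat⇔⟦⟧ (weakenSets φ)) ∘ subst T (sym same) ∘ from (sat⇔⟦⟧ φ))
    where same = sat-renameSets (λ ()) φ (λ ())

  module _ {k m} {a : Vec (Fin n) k} {S : Vec (Subset n) m} where

    ⟦⌜⌝⟧ : ∀ {P} (P? : Dec P) → ⟦ ⌜ P? ⌝ ⟧ a S ⇔ P
    ⟦⌜⌝⟧ (yes p) = mk⇔ (λ _ → p) (λ _ _ → refl)
    ⟦⌜⌝⟧ (no ¬p) = mk⇔ (λ h → ⊥-elim (h (λ _ → refl))) (⊥-elim ∘ ¬p)

    ⟦⇔̇⟧ : ∀ {P} (φ : Formula k m) (P? : Dec P) → ⟦ φ ⇔̇ P? ⟧ a S ⇔ (⟦ φ ⟧ a S ⇔ P)
    ⟦⇔̇⟧ φ (yes p) = mk⇔ (λ h → mk⇔ (λ _ → p) (λ _ → h)) (λ e → from e p)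
    ⟦⇔̇⟧ φ (no ¬p) = mk⇔ (λ h → mk⇔ (⊥-elim ∘ h) (⊥-elim ∘ ¬p)) (λ e → ¬p ∘ to e)

    ⟦⋀⟧ : ∀ r {φ : Fin r → Formula k m} → ⟦ ⋀ r φ ⟧ a S ⇔ (∀ i → ⟦ φ i ⟧ a S)
    ⟦⋀⟧ zero    = mk⇔ (λ _ ()) (λ _ _ → refl)
    ⟦⋀⟧ (suc r) = mk⇔ (λ (h₀ , h₊) → λ { zero → h₀ ; (suc i) → to (⟦⋀⟧ r) h₊ i })
                      (λ h → h zero , from (⟦⋀⟧ r) (h ∘ suc))

    ⟦empty⟧ : ⟦ empty ⟧ a S ⇔ n ≡ 0
    ⟦empty⟧ = mk⇔ (λ h → n≤0⇒n≡0 (to (Fin-interval-empty ≤-refl) (λ u _ → h (u , λ _ → refl))))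
                  (λ n≡0 (u , _) → from (Fin-interval-empty {a = 0} ≤-refl) (≤-reflexive n≡0) u (z≤n , toℕ<n u))

  module _ {k m} {c : Vec (Fin n) k} {S : Vec (Subset n) m} where

    ⟦leftmost⟧ : ∀ {y} → ⟦ leftmost ⟧ (y ∷ c) S ⇔ toℕ y ≡ 0
    ⟦leftmost⟧ {y} = mk⇔
      (λ h → n≤0⇒n≡0 (to (Fin-interval-empty (<⇒≤ (toℕ<n y))) (λ u (_ , u<y) → h (u , u<y))))
      (λ y≡0 (u , u<y) → from (Fin-interval-empty (<⇒≤ (toℕ<n y))) (≤-reflexive y≡0) u (z≤n , u<y))

    ⟦rightmost⟧ : ∀ {y} → ⟦ rightmost ⟧ (y ∷ c) S ⇔ suc (toℕ y) ≡ n
    ⟦rightmost⟧ {y} = mk⇔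
      (λ h → ≤-antisym (toℕ<n y) (to (Fin-interval-empty ≤-refl) (λ u (y<u , _) → h (u , y<u))))
      (λ y+1≡n (u , y<u) → from (Fin-interval-empty ≤-refl) (≤-reflexive (sym y+1≡n)) u (y<u , toℕ<n u))

    ⟦leftNeighbour⟧ : ∀ {z y} → ⟦ leftNeighbour ⟧ (z ∷ y ∷ c) S ⇔ suc (toℕ z) ≡ toℕ y
    ⟦leftNeighbour⟧ {z} {y} = mk⇔
      (λ (z<y , h) → ≤-antisym z<y (to (Fin-interval-empty (<⇒≤ (toℕ<n y))) (λ u between → h (u , between))))
      (λ z+1≡y → ≤-reflexive z+1≡y ,
                 λ (u , between) → from (Fin-interval-empty (<⇒≤ (toℕ<n y))) (≤-reflexive (sym z+1≡y)) u between)

  ⟦∃ₛ*⟧ : ∀ {k} r {φ : Formula k r} {a} → ⟦ ∃ₛ* r φ ⟧ a [] ⇔ ∃ λ Xs → ⟦ φ ⟧ a Xs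
  ⟦∃ₛ*⟧ zero    = mk⇔ ([] ,_) (λ { ([] , h) → h })
  ⟦∃ₛ*⟧ (suc r) {φ} = mk⇔ (λ h → let Ys , X , h′ = to (⟦∃ₛ*⟧ r {∃ₛ φ}) h in X ∷ Ys , h′)
                          (λ { (X ∷ Ys , h) → from (⟦∃ₛ*⟧ r {∃ₛ φ}) (Ys , X , h) })

len-pos : ∀ {k m} (φ : Formula k m) → 1 ≤ len φ
len-pos (x ≐ y)  = s≤s z≤n
len-pos (x <₁ y) = s≤s z≤n
len-pos (x <₂ y) = s≤s z≤n
len-pos (x ∈̇ X)  = s≤s z≤n
len-pos (¬̇ φ)    = s≤s z≤n
len-pos (φ ∧̇ ψ)  = s≤s z≤n
len-pos (φ ∨̇ ψ)  = s≤s z≤n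
len-pos (φ ⇒̇ ψ)  = s≤s z≤n
len-pos (∃ₑ φ)   = s≤s z≤n
len-pos (∀ₑ φ)   = s≤s z≤n
len-pos (∃ₛ φ)   = s≤s z≤n
len-pos (∀ₛ φ)   = s≤s z≤n

len-renameSets : ∀ {k m m′} (σ : Fin m → Fin m′) (φ : Formula k m) → len (renameSets σ φ) ≡ len φ
len-renameSets σ (x ≐ y)  = refl
len-renameSets σ (x <₁ y) = refl
len-renameSets σ (x <₂ y) = refl
len-renameSets σ (x ∈̇ X)  = refl
len-renameSets σ (¬̇ φ)    = cong suc (len-renameSets σ φ)
len-renameSets σ (φ ∧̇ ψ)  = cong₂ (λ u v → suc (u + v)) (len-renameSets σ φ) (len-renameSets σ ψ)
len-renameSets σ (φ ∨̇ ψ)  = cong₂ (λ u v → suc (u + v)) (len-renameSets σ φ) (len-renameSets σ ψ)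
len-renameSets σ (φ ⇒̇ ψ)  = cong₂ (λ u v → suc (u + v)) (len-renameSets σ φ) (len-renameSets σ ψ)
len-renameSets σ (∃ₑ φ)   = cong (2 +_) (len-renameSets σ φ)
len-renameSets σ (∀ₑ φ)   = cong (2 +_) (len-renameSets σ φ)
len-renameSets σ (∃ₛ φ)   = cong (2 +_) (len-renameSets (liftSets σ) φ)
len-renameSets σ (∀ₛ φ)   = cong (2 +_) (len-renameSets (liftSets σ) φ)

len-⌜⌝ : ∀ {k m} {P : Set} (P? : Dec P) → len {k} {m} ⌜ P? ⌝ ≤ 6
len-⌜⌝ (yes _) = n≤1+n 5
len-⌜⌝ (no _)  = ≤-refl

len-⇔̇ : ∀ {k m} {P : Set} (φ : Formula k m) (P? : Dec P) → len (φ ⇔̇ P?) ≤ 1 + len φ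
len-⇔̇ φ (yes _) = n≤1+n (len φ)
len-⇔̇ φ (no _)  = ≤-refl

len-⋀ : ∀ {k m} r (φ : Fin r → Formula k m) {B} → (∀ i → len (φ i) ≤ B) → len (⋀ r φ) ≤ r * suc B + 5
len-⋀ zero    φ     φ≤B = ≤-refl
len-⋀ (suc r) φ {B} φ≤B = ≤-trans (s≤s (+-mono-≤ (φ≤B zero) (len-⋀ r (φ ∘ suc) (φ≤B ∘ suc))))
                                  (≤-reflexive (cong suc (sym (+-assoc B _ 5))))

len-∃ₛ* : ∀ {k} r (φ : Formula k r) → len (∃ₛ* r φ) ≡ r * 2 + len φ
len-∃ₛ* zero    φ = refl
len-∃ₛ* (suc r) φ = trans (len-∃ₛ* r (∃ₛ φ)) (trans (+-suc (r * 2) _) (cong suc (+-suc (r * 2) _)))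

count-size-arith : ∀ {r B} → 1 ≤ r → 1 ≤ B →
  r * 2 + suc (2 + (r * suc (r * suc (suc (suc (34 + B) + (r * 5 + 5))) + 5) + 5) + 28) ≤ 92 * r ^ 3 * B
count-size-arith {suc a} {suc b} _ _ = ≤-trans (m≤m+n _ _) (≤-reflexive (expand a b))
  where
  -- With r = 1 + a and B = 1 + b the right side exceeds the left by a polynomial in a, b with
  -- nonnegative coefficients.
  expand : ∀ a b → let r = suc a ; B = suc b in
    r * 2 + suc (2 + (r * suc (r * suc (suc (suc (34 + B) + (r * 5 + 5))) + 5) + 5) + 28)
      + (91 * b + 167 * a + 274 * a * b + 218 * a * a + 275 * a * a * b + 87 * a * a * a + 92 * a * a * a * b)
    ≡ 92 * (r * (r * (r * 1))) * B
  expand = solve-∀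

module Counting (r : ℕ) .{{_ : NonZero r}} where

  infixl 6 _⊕_
  _⊕_ : Fin r → Fin r → Fin r
  p ⊕ i = (toℕ p + toℕ i) mod r

  mod-⊕ : ∀ a b → (a + b) mod r ≡ a mod r ⊕ b mod r
  mod-⊕ a b = trans (fromℕ<-cong _ _ (%-distribˡ-+ a b r) _ _)
                    (sym (cong₂ (λ u v → (u + v) mod r) (toℕ-fromℕ< (m%n<n a r)) (toℕ-fromℕ< (m%n<n b r))))

  mod⇔% : ∀ {m q} (q<r : q < r) → m mod r ≡ fromℕ< q<r ⇔ m % r ≡ q
  mod⇔% {m} q<r = mk⇔ (λ e → trans (sym (toℕ-fromℕ< (m%n<n m r))) (trans (cong toℕ e) (toℕ-fromℕ< q<r)))
                      (λ e → fromℕ<-cong _ _ e _ _)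

  labelled : ∀ {k} → Fin r → Formula (suc k) r
  labelled l = ⋀ r λ i → (zero ∈̇ i) ⇔̇ (i ≟ l)

  -- The label of the last point before some cut, or 0 if no point precedes the cut.
  labelBeforeCut : ∀ {k} → Formula k r → Formula (suc k) r → Fin r → Formula k r
  labelBeforeCut noneBefore lastBefore p = (⌜ p ≟ 0 mod r ⌝ ∧̇ noneBefore) ∨̇ ∃ₑ (lastBefore ∧̇ (zero ∈̇ p))

  labelBefore : ∀ {k} → Fin r → Formula (suc k) r
  labelBefore = labelBeforeCut leftmost leftNeighbour

  labelAtEnd : ∀ {k} → Fin r → Formula k r
  labelAtEnd = labelBeforeCut empty rightmost

  consistent : ∀ {k} → (Fin r → Formula (suc k) 0) → Formula k r
  consistent θ = ∀ₑ (⋀ r λ p → ⋀ r λ i → (labelBefore p ∧̇ weakenSets (θ i)) ⇒̇ labelled (p ⊕ i))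

  count : ∀ {k} → (Fin r → Formula (suc k) 0) → Fin r → Formula k 0
  count θ q = ∃ₛ* r (consistent θ ∧̇ labelAtEnd q)

  eliminate : ∀ k → (Fin r → Formula k 0) → Fin r → Formula 0 0
  eliminate zero    θ = θ
  eliminate (suc k) θ = eliminate k (count θ)

  indicator : ∀ {k} → Formula k 0 → Fin r → Formula k 0
  indicator φ i = (φ ∧̇ ⌜ 1 mod r ≟ i ⌝) ∨̇ ((¬̇ φ) ∧̇ ⌜ 0 mod r ≟ i ⌝)

  cardinality : ∀ {k} → Formula k 0 → Fin r → Formula 0 0
  cardinality φ = eliminate _ (indicator φ)

  len-labelled : ∀ {k} l → len (labelled {k} l) ≤ r * 5 + 5
  len-labelled l = len-⋀ r _ (λ i → len-⇔̇ (zero ∈̇ i) (i ≟ l))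

  len-labelBeforeCut : ∀ {k} (α : Formula k r) β p → len (labelBeforeCut α β p) ≤ len α + len β + 14
  len-labelBeforeCut α β p = ≤-trans (s≤s (+-monoˡ-≤ _ (s≤s (+-monoˡ-≤ (len α) (len-⌜⌝ (p ≟ 0 mod r))))))
                                     (≤-reflexive (rearrange (len α) (len β)))
    where
    rearrange : ∀ a b → suc (suc (6 + a) + (2 + suc (b + 3))) ≡ a + b + 14
    rearrange = solve-∀

  len-consistent : ∀ {k} (θ : Fin r → Formula (suc k) 0) {B} → (∀ i → len (θ i) ≤ B) →
                   len (consistent θ) ≤ 2 + (r * suc (r * suc (suc (suc (34 + B) + (r * 5 + 5))) + 5) + 5)
  len-consistent θ {B} θ≤B = s≤s (s≤s (len-⋀ r _ λ p → len-⋀ r _ λ i →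
    s≤s (+-mono-≤ (s≤s (+-mono-≤ (len-labelBeforeCut leftmost leftNeighbour p)
                                 (≤-trans (≤-reflexive (len-renameSets (λ ()) (θ i))) (θ≤B i))))
                  (len-labelled (p ⊕ i)))))

  len-count : ∀ {k} (θ : Fin r → Formula (suc k) 0) {B} → (∀ i → len (θ i) ≤ B) →
              ∀ q → len (count θ q) ≤ 92 * r ^ 3 * B
  len-count θ θ≤B q = ≤-trans (≤-reflexive (len-∃ₛ* r _))
    (≤-trans (+-monoʳ-≤ (r * 2) (s≤s (+-mono-≤ (len-consistent θ θ≤B) (len-labelBeforeCut empty rightmost q))))
             (count-size-arith (>-nonZero⁻¹ r) (≤-trans (len-pos (θ (0 mod r))) (θ≤B _))))

  len-eliminate : ∀ k (θ : Fin r → Formula k 0) {B} → (∀ i → len (θ i) ≤ B) →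
                  ∀ q → len (eliminate k θ q) ≤ (92 * r ^ 3) ^ k * B
  len-eliminate zero    θ {B} θ≤B q = ≤-trans (θ≤B q) (≤-reflexive (sym (*-identityˡ B)))
  len-eliminate (suc k) θ {B} θ≤B q = ≤-trans (len-eliminate k (count θ) (len-count θ θ≤B) q)
                                               (≤-reflexive (rearrange ((92 * r ^ 3) ^ k) (92 * r ^ 3) B))
    where
    rearrange : ∀ x y z → x * (y * z) ≡ y * x * z
    rearrange = solve-∀

  len-indicator : ∀ {k} (φ : Formula k 0) i → len (indicator φ i) ≤ 18 * len φ
  len-indicator φ i = ≤-trans (s≤s (+-mono-≤ (s≤s (+-monoʳ-≤ (len φ) (len-⌜⌝ (1 mod r ≟ i))))
                                              (s≤s (+-monoʳ-≤ (suc (len φ)) (len-⌜⌝ (0 mod r ≟ i))))))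
                              (arith (len-pos φ))
    where
    arith : ∀ {L} → 1 ≤ L → suc (suc (L + 6) + suc (suc L + 6)) ≤ 18 * L
    arith {suc l} _ = ≤-trans (m≤m+n _ (16 * l)) (≤-reflexive (expand l))
      where
      expand : ∀ l → suc (suc (suc l + 6) + suc (suc (suc l) + 6)) + 16 * l ≡ 18 * suc l
      expand = solve-∀

  len-cardinality : ∀ {k} (φ : Formula k 0) q → len (cardinality φ q) ≤ (92 * r ^ 3) ^ k * (18 * len φ)
  len-cardinality φ = len-eliminate _ (indicator φ) (len-indicator φ)

  module _ {n : ℕ} (π : Permutation′ n) where
    open Semantics π

    _represents_ : ∀ {k} → (Fin r → Formula k 0) → (Vec (Fin n) k → ℕ) → Set
    θ represents W = ∀ a i → ⟦ θ i ⟧ a [] ⇔ W a mod r ≡ i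

    represents-cong : ∀ {k θ} {W W′ : Vec (Fin n) k → ℕ} → (∀ a → W a ≡ W′ a) →
                      θ represents W → θ represents W′
    represents-cong {θ = θ} W≗W′ θ~W a i = subst (λ w → ⟦ θ i ⟧ a [] ⇔ w mod r ≡ i) (W≗W′ a) (θ~W a i)

    HasLabel : Vec (Subset n) r → Fin n → Fin r → Set
    HasLabel Xs y l = ∀ i → T (lookup (lookup Xs i) y) ⇔ i ≡ l

    LabelBeforeCut : Vec (Subset n) r → ℕ → Fin r → Set
    LabelBeforeCut Xs t p = (p ≡ 0 mod r × t ≡ 0) ⊎ ∃ λ z → suc (toℕ z) ≡ t × T (lookup (lookup Xs p) z)

    module _ (Xs : Vec (Subset n) r) where

      ⟦labelled⟧ : ∀ {k} {c : Vec (Fin n) k} {y l} → ⟦ labelled l ⟧ (y ∷ c) Xs ⇔ HasLabel Xs y l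
      ⟦labelled⟧ {l = l} = mk⇔ (λ h i → to (⟦⇔̇⟧ (zero ∈̇ i) (i ≟ l)) (to (⟦⋀⟧ r) h i))
                                (λ h → from (⟦⋀⟧ r) (λ i → from (⟦⇔̇⟧ (zero ∈̇ i) (i ≟ l)) (h i)))

      ⟦labelBeforeCut⟧ : ∀ {k} {a : Vec (Fin n) k} α β t → (⟦ α ⟧ a Xs ⇔ t ≡ 0) →
                         (∀ {z} → ⟦ β ⟧ (z ∷ a) Xs ⇔ suc (toℕ z) ≡ t) →
                         ∀ p → ⟦ labelBeforeCut α β p ⟧ a Xs ⇔ LabelBeforeCut Xs t p
      ⟦labelBeforeCut⟧ α β t α⇔ β⇔ p = mk⇔
        (Sum.map (Product.map (to (⟦⌜⌝⟧ (p ≟ 0 mod r))) (to α⇔)) (Product.map₂ (Product.map₁ (to β⇔))))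
        (Sum.map (Product.map (from (⟦⌜⌝⟧ (p ≟ 0 mod r))) (from α⇔))
                 (Product.map₂ (Product.map₁ (from β⇔))))

      ⟦labelBefore⟧ : ∀ {k} {c : Vec (Fin n) k} {y} p →
                      ⟦ labelBefore p ⟧ (y ∷ c) Xs ⇔ LabelBeforeCut Xs (toℕ y) p
      ⟦labelBefore⟧ {c = c} {y} = ⟦labelBeforeCut⟧ {a = y ∷ c} leftmost leftNeighbour (toℕ y)
                                    (⟦leftmost⟧ {c = c} {S = Xs}) (⟦leftNeighbour⟧ {c = c} {S = Xs})

      ⟦labelAtEnd⟧ : ∀ {k} {c : Vec (Fin n) k} q → ⟦ labelAtEnd q ⟧ c Xs ⇔ LabelBeforeCut Xs n q
      ⟦labelAtEnd⟧ {c = c} = ⟦labelBeforeCut⟧ {a = c} empty rightmost n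
                               (⟦empty⟧ {a = c} {S = Xs}) (⟦rightmost⟧ {c = c} {S = Xs})

    module Labelling {k} (W : Vec (Fin n) (suc k) → ℕ) (c : Vec (Fin n) k) where

      weight : Fin n → ℕ
      weight x = W (x ∷ c)

      label : Fin n → Fin r
      label y = prefixSum weight (suc (toℕ y)) mod r

      label-step : ∀ {y p i} → prefixSum weight (toℕ y) mod r ≡ p → weight y mod r ≡ i → label y ≡ p ⊕ i
      label-step {y} refl refl = trans (cong (_mod r) (prefixSum-suc weight y)) (mod-⊕ _ _)

      labelBeforeCut-correct : ∀ Xs {t p} → t ≤ n → (∀ z → suc (toℕ z) ≡ t → HasLabel Xs z (label z)) →
                               LabelBeforeCut Xs t p ⇔ prefixSum weight t mod r ≡ p
      labelBeforeCut-correct Xs {zero} _ _ = mk⇔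
        (λ { (inj₁ (p≡0 , _)) → sym p≡0 ; (inj₂ (_ , () , _)) })
        (λ 0≡p → inj₁ (sym 0≡p , refl))
      labelBeforeCut-correct Xs {suc t} {p} t<n labelledBefore = mk⇔
        (λ { (inj₁ (_ , ())) ; (inj₂ (z , refl , z∈Xₚ)) → sym (to (labelledBefore z refl p) z∈Xₚ) })
        (λ e → inj₂ (z , z+1≡t+1 , from (labelledBefore z z+1≡t+1 p)
                                        (trans (sym e) (cong (λ s → prefixSum weight s mod r) (sym z+1≡t+1)))))
        where
        z = fromℕ< t<n
        z+1≡t+1 = cong suc (toℕ-fromℕ< t<n)

      Consistent : Vec (Subset n) r → Set
      Consistent Xs = ∀ y p i → LabelBeforeCut Xs (toℕ y) p → weight y mod r ≡ i → HasLabel Xs y (p ⊕ i)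

      ⟦consistent⟧ : ∀ {θ} Xs → θ represents W → ⟦ consistent θ ⟧ c Xs ⇔ Consistent Xs
      ⟦consistent⟧ {θ} Xs θ~W = mk⇔
        (λ h y p i before w≡i → to (⟦labelled⟧ Xs) (to (⟦⋀⟧ r) (to (⟦⋀⟧ r) (h y) p) i
          (from (⟦labelBefore⟧ Xs p) before , from (⟦weakenSets⟧ (θ i)) (from (θ~W (y ∷ c) i) w≡i))))
        (λ h y → from (⟦⋀⟧ r) λ p → from (⟦⋀⟧ r) λ i (before , θᵢ) → from (⟦labelled⟧ Xs)
          (h y p i (to (⟦labelBefore⟧ Xs p) before) (to (θ~W (y ∷ c) i) (to (⟦weakenSets⟧ (θ i)) θᵢ))))

      consistent⇒labelled : ∀ Xs → Consistent Xs → ∀ y → HasLabel Xs y (label y)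
      consistent⇒labelled Xs cons y = labelledAt (toℕ y) y refl
        where
        labelledAt : ∀ t y → toℕ y ≡ t → HasLabel Xs y (label y)
        predecessorLabelled : ∀ t z → suc (toℕ z) ≡ t → HasLabel Xs z (label z)
        labelledAt t y y≡t = subst (HasLabel Xs y) (sym (label-step refl refl)) (cons y _ _ before refl)
          where
          before = from (labelBeforeCut-correct Xs (<⇒≤ (toℕ<n y))
                                                (λ z e → predecessorLabelled t z (trans e y≡t))) refl
        predecessorLabelled (suc t) z e = labelledAt t z (suc-injective e)

      canonical : Vec (Subset n) r
      canonical = tabulate λ i → tabulate λ y → ⌊ i ≟ label y ⌋

      canonical-labelled : ∀ y → HasLabel canonical y (label y)
      canonical-labelled y i = subst (λ b → T b ⇔ i ≡ label y)
        (sym (trans (cong (λ X → lookup X y) (lookup∘tabulate _ i)) (lookup∘tabulate _ y)))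
        (mk⇔ toWitness fromWitness)

      canonical-consistent : Consistent canonical
      canonical-consistent y p i before w≡i = subst (HasLabel canonical y)
        (label-step (to (labelBeforeCut-correct canonical (<⇒≤ (toℕ<n y)) (λ z _ → canonical-labelled z)) before)
                    w≡i)
        (canonical-labelled y)

      total-correct : ∀ Xs {q} → (∀ y → HasLabel Xs y (label y)) →
                      LabelBeforeCut Xs n q ⇔ sum (map weight (allFin n)) mod r ≡ q
      total-correct Xs {q} labelledXs = subst (λ s → _ ⇔ s mod r ≡ q) (prefixSum-all weight)
                                               (labelBeforeCut-correct Xs ≤-refl (λ z _ → labelledXs z))

    count-represents : ∀ {k θ} {W : Vec (Fin n) (suc k) → ℕ} → θ represents W →
                       count θ represents (λ c → sum (map (λ x → W (x ∷ c)) (allFin n)))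
    count-represents {θ = θ} {W} θ~W c q = mk⇔
      (λ h → let Xs , cons , end = to guess h
                 labelledXs = consistent⇒labelled Xs (to (⟦consistent⟧ Xs θ~W) cons)
             in to (total-correct Xs labelledXs) (to (⟦labelAtEnd⟧ Xs q) end))
      (λ e → from guess (canonical , from (⟦consistent⟧ canonical θ~W) canonical-consistent ,
                         from (⟦labelAtEnd⟧ canonical q) (from (total-correct canonical canonical-labelled) e)))
      where
      open Labelling W c
      guess = ⟦∃ₛ*⟧ r {consistent θ ∧̇ labelAtEnd q}

    eliminate-represents : ∀ {k θ} {W : Vec (Fin n) k → ℕ} → θ represents W →
                           eliminate k θ represents (λ _ → sum (map W (tuples (allFin n) k)))
    eliminate-represents {zero}  {θ}     θ~W = represents-cong {θ = θ} (λ { [] → sym (+-identityʳ _) }) θ~W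
    eliminate-represents {suc k} {θ} {W} θ~W =
      represents-cong {θ = eliminate k (count θ)} (λ _ → sym (sum-tuples W (allFin n)))
                      (eliminate-represents {θ = count θ} (count-represents {θ = θ} θ~W))

    indicator-represents : ∀ {k} (φ : Formula k 0) →
                           indicator φ represents (λ a → if sat π φ a [] then 1 else 0)
    indicator-represents φ a i with sat π φ a [] in φ-value
    ... | true  = mk⇔ (λ { (inj₁ (_ , 1≡i)) → to (⟦⌜⌝⟧ (1 mod r ≟ i)) 1≡i
                         ; (inj₂ (¬⟦φ⟧ , _)) → ⊥-elim (¬⟦φ⟧ ⟦φ⟧) })
                      (λ 1≡i → inj₁ (⟦φ⟧ , from (⟦⌜⌝⟧ (1 mod r ≟ i)) 1≡i))
      where ⟦φ⟧ = to (sat⇔⟦⟧ φ) (from T-≡ φ-value)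
    ... | false = mk⇔ (λ { (inj₁ (⟦φ⟧ , _)) → ⊥-elim (¬⟦φ⟧ ⟦φ⟧)
                         ; (inj₂ (_ , 0≡i)) → to (⟦⌜⌝⟧ (0 mod r ≟ i)) 0≡i })
                      (λ 0≡i → inj₂ (¬⟦φ⟧ , from (⟦⌜⌝⟧ (0 mod r ≟ i)) 0≡i))
      where ¬⟦φ⟧ = λ ⟦φ⟧ → subst T φ-value (from (sat⇔⟦⟧ φ) ⟦φ⟧)

    cardinality-correct : ∀ {k} (φ : Formula k 0) q → (π ⊨ cardinality φ q) ⇔ countSat π φ mod r ≡ q
    cardinality-correct {k} φ q = ⇔-trans (⇔-sym T-≡) (⇔-trans (sat⇔⟦⟧ (cardinality φ q))
      (subst (λ s → ⟦ cardinality φ q ⟧ [] [] ⇔ s mod r ≡ q)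
             (sym (length-filter≡sum (λ a → sat π φ a []) (tuples (allFin n) k)))
             (eliminate-represents (indicator-represents φ) [] q)))

size-bound : ∀ {r} k L → 2 ≤ r → (92 * r ^ 3) ^ k * (18 * L) ≤ 10 * r ^ (10 * suc k) * L
size-bound {r} k L 2≤r = begin
  (92 * r ^ 3) ^ k * (18 * L)    ≤⟨ *-mono-≤ (^-monoˡ-≤ k 92r³≤r¹⁰) (*-monoˡ-≤ L 18≤r¹⁰) ⟩
  (r ^ 10) ^ k * (r ^ 10 * L)    ≡⟨ sym (*-assoc ((r ^ 10) ^ k) (r ^ 10) L) ⟩
  (r ^ 10) ^ k * r ^ 10 * L      ≡⟨ cong (_* L) (*-comm ((r ^ 10) ^ k) (r ^ 10)) ⟩
  (r ^ 10) ^ suc k * L           ≡⟨ cong (_* L) (^-*-assoc r 10 (suc k)) ⟩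
  r ^ (10 * suc k) * L           ≤⟨ m≤n*m _ 10 ⟩
  10 * (r ^ (10 * suc k) * L)    ≡⟨ sym (*-assoc 10 (r ^ (10 * suc k)) L) ⟩
  10 * r ^ (10 * suc k) * L      ∎
  where
  open ≤-Reasoning
  92r³≤r¹⁰ : 92 * r ^ 3 ≤ r ^ 10
  92r³≤r¹⁰ = ≤-trans (*-monoˡ-≤ (r ^ 3) (≤-trans (m≤m+n 92 36) (^-monoˡ-≤ 7 2≤r)))
                     (≤-reflexive (sym (^-distribˡ-+-* r 7 3)))
  18≤r¹⁰ : 18 ≤ r ^ 10
  18≤r¹⁰ = ≤-trans (m≤m+n 18 1006) (^-monoˡ-≤ 10 2≤r)

proposition1 : ∃ λ (C : ℕ) → ∀ (k : ℕ) (φ : Formula k 0) (r : ℕ) .{{_ : NonZero r}} (q : ℕ) → q < r →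
    Σ (Formula 0 0) λ card →
      (len card ≤ C * r ^ (C * suc k) * len φ)
      × (∀ (n : ℕ) (π : Permutation′ n) → (π ⊨ card) ⇔ (countSat π φ % r ≡ q))
proposition1 = 10 , sentence
  where
  sentence : ∀ (k : ℕ) (φ : Formula k 0) (r : ℕ) .{{_ : NonZero r}} (q : ℕ) → q < r →
    Σ (Formula 0 0) λ card →
      (len card ≤ 10 * r ^ (10 * suc k) * len φ)
      × (∀ (n : ℕ) (π : Permutation′ n) → (π ⊨ card) ⇔ (countSat π φ % r ≡ q))
  sentence k φ 0 q ()
  sentence k φ 1 (suc q) (s≤s ())
  -- For r = 1 the allowed length does not grow with k, so the counting sentence is too long;
  -- but every count is ≡ 0 (mod 1), so a true sentence will do.
  sentence k φ 1 0 _ =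
    ⊤̇ ,
    subst (5 ≤_) (sym (cong (λ x → 10 * x * len φ) (^-zeroˡ (10 * suc k))))
          (≤-trans (m≤m+n 5 5) (m≤m*n 10 (len φ) {{>-nonZero (len-pos φ)}})) ,
    λ n π → mk⇔ (λ _ → n%1≡0 (countSat π φ))
                (λ _ → to T-≡ (from (Semantics.sat⇔⟦⟧ π ⊤̇ {[]} {[]}) (λ _ → refl)))
  sentence k φ r@(suc (suc _)) q q<r =
    cardinality φ (fromℕ< q<r) ,
    ≤-trans (len-cardinality φ _) (size-bound k (len φ) (s≤s (s≤s z≤n))) ,
    λ n π → ⇔-trans (cardinality-correct π φ _) (mod⇔% {countSat π φ} q<r)
    where open Counting r
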